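{- Let $n\geq 3$ be an integer, and let $i,j,k\in\{1,\dots,n\}$ be such that $j\notin\{i,k\}$ and $\{1,\dots,n\}\setminus\{i,j,k\}\neq\emptyset$. Let $P$ be a path on at least two vertices, and let $c$ be the colouring of $P$ obtained by giving one endpoint $x$ the colour $i$, the other endpoint $y$ the colour $j$, and every other vertex the colour $k$. Then $(P,c)$ is a cliquewidth-$n$ pair.
   Context: Graphs are finite and simple. A colouring of $G$ with colours $\{1,\dots,n\}$ is a map $c:V(G)\to\{1,\dots,n\}$; colour $i$ is used if $c^{ -1}(i)\ne\emptyset$. $(G,c)$ is a cliquewidth-$n$ pair if $|V(G)|\leq 1$ or: (OP1) $G$ is the disjoint union of nonempty $G_1,G_2$ with $(G_1,c|_{V(G_1)}),(G_2,c|_{V(G_2)})$ cliquewidth-$n$ pairs; or (OP2) there are a colouring $c'$ of $G$ and distinct $i,j$, both used by $c'$, with $(G,c')$ a cliquewidth-$n$ pair and $c$ obtained from $c'$ by recolouring every vertex of colour $i$ to $j$; or (OP3) there are a proper spanning subgraph $G'$ of $G$ and distinct $i,j$ with $(G',c)$ a cliquewidth-$n$ pair and $G$ obtained from $G'$ by adding an edge between every non-adjacent pair $u,v$ with $u$ coloured $i$ and $v$ coloured $j$. -}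

module Defs where

open import Data.Nat using (ℕ; zero; suc; _≤_)
open import Data.Nat.Properties using (1+n≢n)
open import Data.Fin using (Fin; toℕ)
open import Data.Bool using (Bool; true; false; _∨_)
open import Data.Bool.Properties using (∨-comm)
open import Data.Sum using (_⊎_; inj₁; inj₂; [_,_])
open import Data.Product using (_×_; Σ; ∃; ∃-syntax; _,_)
open import Relation.Nullary using (¬_; yes; no)
open import Relation.Nullary.Decidable using (⌊_⌋)
open import Relation.Binary.PropositionalEquality using (_≡_; _≢_; refl; sym)
open import Function.Bundles using (_↔_; Inverse)
open import Data.Fin using (_≟_)
import Data.Nat as ℕ

record Graph (m : ℕ) : Set where
  field
    adj   : Fin m → Fin m → Bool
    symm  : ∀ u v → adj u v ≡ adj v u
    irrfl : ∀ u → adj u u ≡ false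
open Graph public

-- A colouring with colours {1,…,n}, represented as Fin n.
Colouring : ℕ → ℕ → Set
Colouring m n = Fin m → Fin n

Used : ∀ {m n} → Colouring m n → Fin n → Set
Used c i = ∃[ v ] c v ≡ i

unionAdj : ∀ {a b} → Graph a → Graph b → (Fin a ⊎ Fin b) → (Fin a ⊎ Fin b) → Bool
unionAdj G₁ G₂ (inj₁ u) (inj₁ v) = adj G₁ u v
unionAdj G₁ G₂ (inj₂ u) (inj₂ v) = adj G₂ u v
unionAdj G₁ G₂ (inj₁ u) (inj₂ v) = false
unionAdj G₁ G₂ (inj₂ u) (inj₁ v) = false

-- (G , c) is a cliquewidth-n pair.
-- Vertex sets are Fin m; the "disjoint union" of OP1 is expressed via a
-- bijection f : V(G) ↔ V(G₁) ⊎ V(G₂) that carries the edges and the colouring.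
data CWPair (n : ℕ) : {m : ℕ} → Graph m → Colouring m n → Set where
  small : ∀ {m} (G : Graph m) (c : Colouring m n) → m ≤ 1 → CWPair n G c
  op1 : ∀ {m a b} (G : Graph m) (c : Colouring m n)
          (G₁ : Graph (suc a)) (G₂ : Graph (suc b))
          (f : Fin m ↔ (Fin (suc a) ⊎ Fin (suc b))) →
          (∀ u v → adj G u v ≡ unionAdj G₁ G₂ (Inverse.to f u) (Inverse.to f v)) →
          CWPair n G₁ (λ u → c (Inverse.from f (inj₁ u))) →
          CWPair n G₂ (λ u → c (Inverse.from f (inj₂ u))) →
          CWPair n G c
  op2 : ∀ {m} (G : Graph m) (c c' : Colouring m n) (i j : Fin n) →
          i ≢ j → Used c' i → Used c' j →
          CWPair n G c' →
          (∀ v → (c' v ≡ i → c v ≡ j) × (c' v ≢ i → c v ≡ c' v)) →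
          CWPair n G c
  op3 : ∀ {m} (G G' : Graph m) (c : Colouring m n) (i j : Fin n) →
          i ≢ j →
          (∃[ u ] ∃[ v ] (adj G u v ≡ true × adj G' u v ≡ false)) →
          CWPair n G' c →
          (∀ u v → adj G u v ≡ true →
                     adj G' u v ≡ true ⊎ ((c u ≡ i × c v ≡ j) ⊎ (c u ≡ j × c v ≡ i))) →
          (∀ u v → adj G' u v ≡ true → adj G u v ≡ true) →
          (∀ u v → u ≢ v → (c u ≡ i × c v ≡ j) → adj G u v ≡ true) →
          CWPair n G c

nbr : ℕ → ℕ → Bool
nbr x y = ⌊ suc x ℕ.≟ y ⌋

pathAdj : ∀ {m} → Fin m → Fin m → Bool
pathAdj u v = nbr (toℕ u) (toℕ v) ∨ nbr (toℕ v) (toℕ u)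

nbr-irr : ∀ x → nbr x x ≡ false
nbr-irr x with suc x ℕ.≟ x
... | yes p = Data.Empty.⊥-elim (1+n≢n p) where import Data.Empty
... | no _ = refl

Path : (m : ℕ) → Graph m
Path m = record
  { adj = pathAdj
  ; symm = λ u v → ∨-comm (nbr (toℕ u) (toℕ v)) (nbr (toℕ v) (toℕ u))
  ; irrfl = λ u → irr u }
  where
  irr : ∀ u → pathAdj {m} u u ≡ false
  irr u rewrite nbr-irr (toℕ u) = refl

pathColouring : ∀ {n} (p : ℕ) (i j k : Fin n) → Colouring (suc (suc p)) n
pathColouring p i j k v with toℕ v ℕ.≟ 0 | toℕ v ℕ.≟ suc p
... | yes _ | _     = i
... | no _  | yes _ = j
... | no _  | no _  = k

{-# OPTIONS --safe #-}
-- Induction on the length, keeping a spare colour l ∉ {i, j, k}.  The path i k…k j is the path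
-- i k…k l one vertex shorter (l playing the role of j, j that of the spare colour) with a vertex of
-- colour j added by OP1, joined to the l-coloured end by OP3 (l and j each colour a single vertex,
-- so exactly the one new edge appears), after which OP2 recolours l to k.  OP2 needs k to be in use
-- already, which fails only for i k j with i ≢ k; that path is obtained from the edge i k by adding
-- j and joining k to j.
module Submission where

open import Defs
open import Data.Nat using (ℕ; zero; suc; _<_; _≥_; s≤s; z≤n)
import Data.Nat.Properties as ℕ
open import Data.Fin using (Fin; zero; suc; toℕ; fromℕ; inject₁; _≟_)
open import Data.Fin.Properties using (toℕ-fromℕ; toℕ-inject₁; toℕ-inject₁-≢; toℕ-injective; toℕ<n)
open import Data.Fin.Relation.Unary.Top using (view; ‵fromℕ; ‵inject₁; view-fromℕ; view-inject₁)
open import Data.Bool using (true; false; _∨_)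
open import Data.Sum using (_⊎_; inj₁; inj₂; [_,_]′)
open import Data.Product using (∃-syntax; _×_; _,_)
open import Function using (_∘_)
open import Function.Bundles using (_↔_; Inverse; mk↔ₛ′)
open import Relation.Nullary using (yes; no; contradiction)
open import Relation.Binary.PropositionalEquality
  using (_≡_; _≢_; _≗_; refl; sym; trans; cong; cong₂; subst)

CWPair-resp-≗ : ∀ {n m} {G : Graph m} {c d : Colouring m n} → c ≗ d → CWPair n G c → CWPair n G d
CWPair-resp-≗ c≗d (small G _ m≤1) = small G _ m≤1
CWPair-resp-≗ c≗d (op1 G _ G₁ G₂ f G≡G₁⊎G₂ P₁ P₂) =
  op1 G _ G₁ G₂ f G≡G₁⊎G₂ (CWPair-resp-≗ (c≗d ∘ from ∘ inj₁) P₁) (CWPair-resp-≗ (c≗d ∘ from ∘ inj₂) P₂)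
  where open Inverse f using (from)
CWPair-resp-≗ c≗d (op2 G _ c' i j i≢j used-i used-j P recoloured) =
  op2 G _ c' i j i≢j used-i used-j P λ v →
    let (to-j , fixed) = recoloured v in
    trans (sym (c≗d v)) ∘ to-j , trans (sym (c≗d v)) ∘ fixed
CWPair-resp-≗ {c = c} {d} c≗d (op3 G G' _ i j i≢j proper P new old joined) =
  op3 G G' d i j i≢j proper (CWPair-resp-≗ c≗d P) new′ old joined′
  where
  transport : ∀ {u v a b} → c u ≡ a × c v ≡ b → d u ≡ a × d v ≡ b
  transport {u} {v} (cu , cv) = trans (sym (c≗d u)) cu , trans (sym (c≗d v)) cv
  new′ : ∀ u v → adj G u v ≡ true → adj G' u v ≡ true ⊎ ((d u ≡ i × d v ≡ j) ⊎ (d u ≡ j × d v ≡ i))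
  new′ u v uv with new u v uv
  ... | inj₁ uv′ = inj₁ uv′
  ... | inj₂ (inj₁ ij) = inj₂ (inj₁ (transport ij))
  ... | inj₂ (inj₂ ji) = inj₂ (inj₂ (transport ji))
  joined′ : ∀ u v → u ≢ v → d u ≡ i × d v ≡ j → adj G u v ≡ true
  joined′ u v u≢v (du , dv) = joined u v u≢v (trans (c≗d u) du , trans (c≗d v) dv)

splitLast : ∀ {m} → Fin (suc m) → Fin m ⊎ Fin 1
splitLast v with view v
... | ‵fromℕ     = inj₂ zero
... | ‵inject₁ a = inj₁ a

splitLast-inject₁ : ∀ {m} (a : Fin m) → splitLast (inject₁ a) ≡ inj₁ a
splitLast-inject₁ a rewrite view-inject₁ a = refl

splitLast-fromℕ : ∀ m → splitLast (fromℕ m) ≡ inj₂ zero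
splitLast-fromℕ m rewrite view-fromℕ m = refl

suc↔⊎ : ∀ {m} → Fin (suc m) ↔ (Fin m ⊎ Fin 1)
suc↔⊎ = mk↔ₛ′ splitLast joinLast splitLast-joinLast joinLast-splitLast
  where
  joinLast : ∀ {m} → Fin m ⊎ Fin 1 → Fin (suc m)
  joinLast = [ inject₁ , (λ _ → fromℕ _) ]′
  splitLast-joinLast : ∀ {m} (x : Fin m ⊎ Fin 1) → splitLast (joinLast x) ≡ x
  splitLast-joinLast (inj₁ a)    = splitLast-inject₁ a
  splitLast-joinLast (inj₂ zero) = splitLast-fromℕ _
  joinLast-splitLast : ∀ {m} (v : Fin (suc m)) → joinLast (splitLast v) ≡ v
  joinLast-splitLast v with view v
  ... | ‵fromℕ     = refl
  ... | ‵inject₁ a = refl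

_∷ʳ_ : ∀ {m n} → Colouring m n → Fin n → Colouring (suc m) n
(d ∷ʳ j) v = [ d , (λ _ → j) ]′ (splitLast v)

∷ʳ-inject₁ : ∀ {m n} {d : Colouring m n} {j} (a : Fin m) → (d ∷ʳ j) (inject₁ a) ≡ d a
∷ʳ-inject₁ {d = d} {j} a = cong [ d , (λ _ → j) ]′ (splitLast-inject₁ a)

∷ʳ-fromℕ : ∀ {m n} {d : Colouring m n} {j} → (d ∷ʳ j) (fromℕ m) ≡ j
∷ʳ-fromℕ {m} {d = d} {j} = cong [ d , (λ _ → j) ]′ (splitLast-fromℕ m)

K₁ : Graph 1
K₁ = record { adj = λ _ _ → false ; symm = λ _ _ → refl ; irrfl = λ _ → refl }

unionAdj-symm : ∀ {a b} (G₁ : Graph a) (G₂ : Graph b) x y → unionAdj G₁ G₂ x y ≡ unionAdj G₁ G₂ y x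
unionAdj-symm G₁ G₂ (inj₁ x) (inj₁ y) = symm G₁ x y
unionAdj-symm G₁ G₂ (inj₁ x) (inj₂ y) = refl
unionAdj-symm G₁ G₂ (inj₂ x) (inj₁ y) = refl
unionAdj-symm G₁ G₂ (inj₂ x) (inj₂ y) = symm G₂ x y

unionAdj-irrefl : ∀ {a b} (G₁ : Graph a) (G₂ : Graph b) x → unionAdj G₁ G₂ x x ≡ false
unionAdj-irrefl G₁ G₂ (inj₁ x) = irrfl G₁ x
unionAdj-irrefl G₁ G₂ (inj₂ x) = irrfl G₂ x

_+K₁ : ∀ {m} → Graph m → Graph (suc m)
H +K₁ = record
  { adj   = λ u v → unionAdj H K₁ (splitLast u) (splitLast v)
  ; symm  = λ u v → unionAdj-symm H K₁ (splitLast u) (splitLast v)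
  ; irrfl = λ u → unionAdj-irrefl H K₁ (splitLast u)
  }

+K₁-fromℕ : ∀ {m} (H : Graph m) u → adj (H +K₁) u (fromℕ m) ≡ false
+K₁-fromℕ {m} H u rewrite splitLast-fromℕ m with splitLast u
... | inj₁ _    = refl
... | inj₂ zero = refl

+K₁-CWPair : ∀ {n m} {H : Graph (suc m)} {d : Colouring (suc m) n} (j : Fin n) →
             CWPair n H d → CWPair n (H +K₁) (d ∷ʳ j)
+K₁-CWPair {H = H} j P =
  op1 (H +K₁) _ H K₁ suc↔⊎ (λ _ _ → refl)
      (CWPair-resp-≗ (sym ∘ ∷ʳ-inject₁) P) (small K₁ _ (s≤s z≤n))

pendant-CWPair : ∀ {n m} {H : Graph (suc m)} {G : Graph (suc (suc m))} {d : Colouring (suc m) n}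
                 {x j : Fin n} →
  x ≢ j → (∀ a → d a ≢ j) → ∃[ a ] d a ≡ x →
  (∀ a b → adj G (inject₁ a) (inject₁ b) ≡ adj H a b) →
  (∀ a → adj G (inject₁ a) (fromℕ (suc m)) ≡ true → d a ≡ x) →
  (∀ a → d a ≡ x → adj G (inject₁ a) (fromℕ (suc m)) ≡ true) →
  CWPair n H d → CWPair n G (d ∷ʳ j)
pendant-CWPair {_} {m} {H} {G} {d} {x} {j} x≢j d≢j (a₀ , da₀) G-old adj⇒x x⇒adj P =
  op3 G (H +K₁) c x j x≢j (inject₁ a₀ , fromℕ (suc m) , x⇒adj a₀ da₀ , +K₁-fromℕ H (inject₁ a₀))
      (+K₁-CWPair j P) new old joined
  where
  c = d ∷ʳ j
  -- Abstracting over view u and view v also unfolds splitLast, so c and adj (H +K₁) compute in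
  -- each branch.
  new : ∀ u v → adj G u v ≡ true → adj (H +K₁) u v ≡ true ⊎ ((c u ≡ x × c v ≡ j) ⊎ (c u ≡ j × c v ≡ x))
  new u v uv with view u | view v
  ... | ‵inject₁ a | ‵inject₁ b = inj₁ (trans (sym (G-old a b)) uv)
  ... | ‵inject₁ a | ‵fromℕ     = inj₂ (inj₁ (adj⇒x a uv , refl))
  ... | ‵fromℕ     | ‵inject₁ b = inj₂ (inj₂ (refl , adj⇒x b (trans (symm G _ _) uv)))
  ... | ‵fromℕ     | ‵fromℕ     = contradiction (trans (sym (irrfl G _)) uv) λ ()
  old : ∀ u v → adj (H +K₁) u v ≡ true → adj G u v ≡ true
  old u v uv with view u | view v
  ... | ‵inject₁ a | ‵inject₁ b = trans (G-old a b) uv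
  ... | ‵inject₁ _ | ‵fromℕ     = contradiction uv λ ()
  ... | ‵fromℕ     | ‵inject₁ _ = contradiction uv λ ()
  ... | ‵fromℕ     | ‵fromℕ     = contradiction uv λ ()
  joined : ∀ u v → u ≢ v → c u ≡ x × c v ≡ j → adj G u v ≡ true
  joined u v _ (cu , cv) with view u | view v
  ... | ‵fromℕ     | _          = contradiction (sym cu) x≢j
  ... | ‵inject₁ _ | ‵inject₁ b = contradiction cv (d≢j b)
  ... | ‵inject₁ a | ‵fromℕ     = x⇒adj a cu

nbr⇒suc : ∀ x y → nbr x y ≡ true → suc x ≡ y
nbr⇒suc x y xy with suc x ℕ.≟ y
... | yes x+1≡y = x+1≡y
... | no  _     = contradiction xy λ ()

pathAdj-inject₁ : ∀ {m} (a b : Fin m) → pathAdj (inject₁ a) (inject₁ b) ≡ pathAdj a b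
pathAdj-inject₁ a b = cong₂ (λ x y → nbr x y ∨ nbr y x) (toℕ-inject₁ a) (toℕ-inject₁ b)

pathAdj-inject₁-suc : ∀ {m} (a : Fin m) → pathAdj (inject₁ a) (suc a) ≡ true
pathAdj-inject₁-suc a rewrite toℕ-inject₁ a | ℕ.≟-diag (refl {x = suc (toℕ a)}) = refl

pathAdj-inject₁-fromℕ : ∀ m (a : Fin (suc m)) →
                        pathAdj (inject₁ a) (fromℕ (suc m)) ≡ true → a ≡ fromℕ m
pathAdj-inject₁-fromℕ m a rewrite toℕ-inject₁ a | toℕ-fromℕ m = adjacent
  where
  adjacent : nbr (toℕ a) (suc m) ∨ nbr (suc m) (toℕ a) ≡ true → a ≡ fromℕ m
  adjacent e with nbr (toℕ a) (suc m) in a→m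
  ... | true  = toℕ-injective (trans (ℕ.suc-injective (nbr⇒suc _ _ a→m)) (sym (toℕ-fromℕ m)))
  ... | false = contradiction (subst (_< suc m) (sym (nbr⇒suc _ _ e)) (toℕ<n a))
                              (ℕ.<-asym (ℕ.n<1+n (suc m)))

Path-pendant-CWPair : ∀ {n m} {d : Colouring (suc m) n} {x j : Fin n} →
  x ≢ j → (∀ a → d a ≢ j) → d (fromℕ m) ≡ x → (∀ a → d a ≡ x → a ≡ fromℕ m) →
  CWPair n (Path (suc m)) d → CWPair n (Path (suc (suc m))) (d ∷ʳ j)
Path-pendant-CWPair {m = m} {d} {x} x≢j d≢j last≡x x⇒last =
  pendant-CWPair x≢j d≢j (fromℕ m , last≡x) pathAdj-inject₁
    (λ a adj → subst (λ a → d a ≡ x) (sym (pathAdj-inject₁-fromℕ m a adj)) last≡x)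
    (λ a da≡x → subst (λ a → pathAdj (inject₁ a) (fromℕ (suc m)) ≡ true) (sym (x⇒last a da≡x))
                      (pathAdj-inject₁-suc (fromℕ m)))

data PathVertex (p : ℕ) : Fin (suc (suc p)) → Set where
  first : PathVertex p zero
  inner : (c : Fin p) → PathVertex p (suc (inject₁ c))
  last  : PathVertex p (fromℕ (suc p))

pathVertex : ∀ {p} (v : Fin (suc (suc p))) → PathVertex p v
pathVertex v with view v
... | ‵fromℕ           = last
... | ‵inject₁ zero    = first
... | ‵inject₁ (suc c) = inner c

module _ {n} (p : ℕ) (i j k : Fin n) where

  pathColouring-inner : (c : Fin p) → pathColouring p i j k (suc (inject₁ c)) ≡ k
  pathColouring-inner c with toℕ (suc (inject₁ c)) ℕ.≟ 0 | toℕ (suc (inject₁ c)) ℕ.≟ suc p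
  ... | no _ | yes c+1≡p+1 = contradiction (sym (ℕ.suc-injective c+1≡p+1)) (toℕ-inject₁-≢ c)
  ... | no _ | no _        = refl

  pathColouring-last : pathColouring p i j k (fromℕ (suc p)) ≡ j
  pathColouring-last with toℕ (fromℕ (suc p)) ℕ.≟ 0 | toℕ (fromℕ (suc p)) ℕ.≟ suc p
  ... | no _ | yes _         = refl
  ... | no _ | no last≢p+1   = contradiction (toℕ-fromℕ (suc p)) last≢p+1

  pathColouring-suc : (c : Fin (suc p)) →
                      pathColouring p i j k (suc c) ≢ j → pathColouring p i j k (suc c) ≡ k
  pathColouring-suc c c≢j with pathVertex (suc c)
  ... | inner c′ = pathColouring-inner c′
  ... | last     = contradiction pathColouring-last c≢j

  pathColouring-≡-last : j ≢ i → j ≢ k → ∀ v → pathColouring p i j k v ≡ j → v ≡ fromℕ (suc p)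
  pathColouring-≡-last j≢i j≢k v v≡j with pathVertex v
  ... | first   = contradiction (sym v≡j) j≢i
  ... | inner c = contradiction (trans (sym v≡j) (pathColouring-inner c)) j≢k
  ... | last    = refl

  pathColouring-≢ : ∀ {x} → x ≢ i → x ≢ j → x ≢ k → ∀ v → pathColouring p i j k v ≢ x
  pathColouring-≢ x≢i x≢j x≢k v v≡x with pathVertex v
  ... | first   = x≢i (sym v≡x)
  ... | inner c = x≢k (trans (sym v≡x) (pathColouring-inner c))
  ... | last    = x≢j (trans (sym v≡x) pathColouring-last)

module _ {n} (q : ℕ) {i j k l : Fin n}
         (l≢i : l ≢ i) (l≢j : l ≢ j) (l≢k : l ≢ k) (j≢i : j ≢ i) (j≢k : j ≢ k) where

  pathColouring-∷ʳ-CWPair : CWPair n (Path (suc (suc q))) (pathColouring q i l k) →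
                            CWPair n (Path (suc (suc (suc q)))) (pathColouring q i l k ∷ʳ j)
  pathColouring-∷ʳ-CWPair =
    Path-pendant-CWPair l≢j (pathColouring-≢ q i l k j≢i (l≢j ∘ sym) j≢k) (pathColouring-last q i l k)
                        (pathColouring-≡-last q i l k l≢i l≢k)

  pathColouring-recolour : ∀ v → let c = pathColouring q i l k ∷ʳ j in
    (c v ≡ l → pathColouring (suc q) i j k v ≡ k) × (c v ≢ l → pathColouring (suc q) i j k v ≡ c v)
  pathColouring-recolour v with pathVertex v
  ... | first   = (λ i≡l → contradiction (sym i≡l) l≢i) , (λ _ → refl)
  ... | inner c rewrite ∷ʳ-inject₁ {d = pathColouring q i l k} {j} (suc c) =
    (λ _ → pathColouring-inner (suc q) i j k c) ,
    (λ c≢l → trans (pathColouring-inner (suc q) i j k c) (sym (pathColouring-suc q i l k c c≢l)))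
  ... | last rewrite ∷ʳ-fromℕ {d = pathColouring q i l k} {j} =
    (λ j≡l → contradiction (sym j≡l) l≢j) , (λ _ → pathColouring-last (suc q) i j k)

  pathColouring-step : Used (pathColouring q i l k) k →
                       CWPair n (Path (suc (suc q))) (pathColouring q i l k) →
                       CWPair n (Path (suc (suc (suc q)))) (pathColouring (suc q) i j k)
  pathColouring-step (a , a≡k) P =
    op2 (Path _) _ (pathColouring q i l k ∷ʳ j) l k l≢k
        (inject₁ (fromℕ (suc q)) , trans (∷ʳ-inject₁ (fromℕ (suc q))) (pathColouring-last q i l k))
        (inject₁ a , trans (∷ʳ-inject₁ a) a≡k)
        (pathColouring-∷ʳ-CWPair P) pathColouring-recolour

edge-CWPair : ∀ {n} {i j k : Fin n} → j ≢ i → CWPair n (Path 2) (pathColouring 0 i j k)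
edge-CWPair {i = i} j≢i =
  CWPair-resp-≗ (λ { zero → refl ; (suc zero) → refl })
    (Path-pendant-CWPair {d = λ _ → i} (j≢i ∘ sym) (λ _ → j≢i ∘ sym) refl (λ { zero _ → refl })
                         (small (Path 1) _ (s≤s z≤n)))

pathColouring-CWPair : ∀ {n} p {i j k l : Fin n} → j ≢ i → j ≢ k → l ≢ i → l ≢ j → l ≢ k →
                       CWPair n (Path (suc (suc p))) (pathColouring p i j k)
pathColouring-CWPair zero j≢i _ _ _ _ = edge-CWPair j≢i
pathColouring-CWPair (suc zero) {i = i} {k = k} j≢i j≢k l≢i l≢j l≢k with i ≟ k
... | yes refl = pathColouring-step 0 l≢i l≢j l≢k j≢i j≢k (zero , refl) (edge-CWPair l≢i)
... | no i≢k   =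
  CWPair-resp-≗ (λ { zero → refl ; (suc zero) → refl ; (suc (suc zero)) → refl })
    (pathColouring-∷ʳ-CWPair 0 (i≢k ∘ sym) (j≢k ∘ sym) (l≢k ∘ sym) j≢i (l≢j ∘ sym)
                             (edge-CWPair (i≢k ∘ sym)))
pathColouring-CWPair (suc (suc r)) {i = i} {k = k} {l = l} j≢i j≢k l≢i l≢j l≢k =
  pathColouring-step (suc r) l≢i l≢j l≢k j≢i j≢k (suc zero , pathColouring-inner (suc r) i l k zero)
    (pathColouring-CWPair (suc r) l≢i l≢k j≢i (l≢j ∘ sym) j≢k)

lemma8 : (n : ℕ) → n ≥ 3 → (i j k : Fin n) → j ≢ i → j ≢ k →
         (∃[ l ] (l ≢ i × l ≢ j × l ≢ k)) →
         (p : ℕ) → CWPair n (Path (suc (suc p))) (pathColouring p i j k)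
-- n ≥ 3 is redundant: i, j and l are already distinct.
lemma8 n _ i j k j≢i j≢k (l , l≢i , l≢j , l≢k) p = pathColouring-CWPair p j≢i j≢k l≢i l≢j l≢k
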